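{- Let $\varphi,\psi\in\mathrm{rLTL}(\mathcal P)$ and suppose $\varphi$ contains no robust always operator $\boxdot$ and no robust release operator $\dot{\mathcal R}$. Then $\varphi\Rrightarrow\psi$ is semantically equivalent to $\neg\varphi\vee\psi$, i.e., $V(\sigma,\varphi\Rrightarrow\psi)=V(\sigma,\neg\varphi\vee\psi)$ for every $\sigma\in(2^{\mathcal P})^\omega$.
   Context: Let $\mathcal P$ be a finite nonempty set of atomic propositions, $\Sigma=2^{\mathcal P}$, and for $\sigma\in\Sigma^\omega$ let $\sigma_{i..}$ be its suffix starting at position $i$. $\mathrm{rLTL}(\mathcal P)$ is the set of formulae built from $p\in\mathcal P$ with $\neg,\wedge,\vee$, robust implication $\Rrightarrow$, robust next $\odot$, robust eventually $\dot\Diamond$, robust always $\boxdot$, robust until $\dot{\mathcal U}$, robust release $\dot{\mathcal R}$. Truth values $\mathbb B_5=\{0000,0001,0011,0111,1111\}$ with linear order $0000\prec0001\prec0011\prec0111\prec1111$; $\overline a=0000$ if $a=1111$ and $1111$ otherwise; $a\to b=1111$ if $a\preceq b$, else $b$. Valuation $V:\Sigma^\omega\times\mathrm{rLTL}(\mathcal P)\to\mathbb B_5$, $V_k$ its $k$-th bit: $V(\sigma,p)=1111$ if $p\in\sigma(0)$ else $0000$; $V(\sigma,\neg\varphi)=\overline{V(\sigma,\varphi)}$; $V(\sigma,\varphi\wedge\psi)=\min$ and $V(\sigma,\varphi\vee\psi)=\max$ of the two values; $V(\sigma,\varphi\Rrightarrow\psi)=V(\sigma,\varphi)\to V(\sigma,\psi)$;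 $V(\sigma,\odot\varphi)=V(\sigma_{1..},\varphi)$; $V_k(\sigma,\dot\Diamond\varphi)=\sup_iV_k(\sigma_{i..},\varphi)$; $V(\sigma,\boxdot\varphi)=(\inf_iV_1(\sigma_{i..},\varphi),\sup_j\inf_{i\ge j}V_2(\sigma_{i..},\varphi),\inf_j\sup_{i\ge j}V_3(\sigma_{i..},\varphi),\sup_iV_4(\sigma_{i..},\varphi))$; $V_k(\sigma,\varphi\dot{\mathcal U}\psi)=\sup_j\min\{V_k(\sigma_{j..},\psi),\inf_{i<j}V_k(\sigma_{i..},\varphi)\}$; with $M_k(j)=\max\{V_k(\sigma_{j..},\psi),\sup_{i<j}V_k(\sigma_{i..},\varphi)\}$: $V_1(\sigma,\varphi\dot{\mathcal R}\psi)=\inf_jM_1(j)$, $V_2=\sup_k\inf_{j\ge k}M_2(j)$, $V_3=\inf_k\sup_{j\ge k}M_3(j)$, $V_4=\sup_jM_4(j)$. -}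

module Defs where

open import Data.Nat using (ℕ; zero; suc; _+_; _<_; _≥_)
open import Data.Fin using (Fin; zero; suc)
open import Data.Bool using (Bool; T)
open import Data.Product using (_×_; ∃-syntax)
open import Data.Sum using (_⊎_)
open import Relation.Nullary using (¬_)

-- Atomic propositions: a finite nonempty set, Fin (suc n).
-- A letter of Σ = 2^P is a subset of P, given by its characteristic function.
Letter : ℕ → Set
Letter n = Fin (suc n) → Bool

Word : ℕ → Set
Word n = ℕ → Letter n

suffix : ∀ {n} → Word n → ℕ → Word n
suffix σ i t = σ (i + t)

data Form (A : Set) : Set where
  atom    : A → Form A
  ¬ᵣ_     : Form A → Form A
  _∧ᵣ_    : Form A → Form A → Form A
  _∨ᵣ_    : Form A → Form A → Form A
  _⇛_     : Form A → Form A → Form A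
  ⊙_      : Form A → Form A
  ◇_      : Form A → Form A
  □_      : Form A → Form A
  _𝒰_     : Form A → Form A → Form A
  _ℛ_     : Form A → Form A → Form A

-- Truth values of B₅ as 4-tuples of bits, bit k (k = 0..3 standing for
-- V₁..V₄) represented as a proposition ("bit k is 1").
Val : Set₁
Val = Fin 4 → Set

isTop : Val → Set
isTop a = ∀ j → a j

-- order on B₅ (on the monotone 4-bit chains it is the bitwise order)
_⪯_ : Val → Val → Set
a ⪯ b = ∀ j → a j → b j

negV : Val → Val
negV a k = ¬ isTop a

minV maxV : Val → Val → Val
minV a b k = a k × b k
maxV a b k = a k ⊎ b k

impV : Val → Val → Val
impV a b k = (a ⪯ b) ⊎ b k

alwaysV : (ℕ → Val) → Val
alwaysV v zero                   = ∀ i → v i zero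
alwaysV v (suc zero)             = ∃[ j ] (∀ i → i ≥ j → v i (suc zero))
alwaysV v (suc (suc zero))       = ∀ j → ∃[ i ] (i ≥ j × v i (suc (suc zero)))
alwaysV v (suc (suc (suc zero))) = ∃[ i ] v i (suc (suc (suc zero)))

untilV : (ℕ → Val) → (ℕ → Val) → Val
untilV f g k = ∃[ j ] (g j k × (∀ i → i < j → f i k))

relM : (ℕ → Val) → (ℕ → Val) → Fin 4 → ℕ → Set
relM f g k j = g j k ⊎ ∃[ i ] (i < j × f i k)

releaseV : (ℕ → Val) → (ℕ → Val) → Val
releaseV f g zero                   = ∀ j → relM f g zero j
releaseV f g (suc zero)             = ∃[ m ] (∀ j → j ≥ m → relM f g (suc zero) j)
releaseV f g (suc (suc zero))       = ∀ m → ∃[ j ] (j ≥ m × relM f g (suc (suc zero)) j)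
releaseV f g (suc (suc (suc zero))) = ∃[ j ] relM f g (suc (suc (suc zero))) j

V : ∀ {n} → Word n → Form (Fin (suc n)) → Val
V σ (atom p) k  = T (σ 0 p)
V σ (¬ᵣ φ)      = negV (V σ φ)
V σ (φ ∧ᵣ ψ)    = minV (V σ φ) (V σ ψ)
V σ (φ ∨ᵣ ψ)    = maxV (V σ φ) (V σ ψ)
V σ (φ ⇛ ψ)     = impV (V σ φ) (V σ ψ)
V σ (⊙ φ)       = V (suffix σ 1) φ
V σ (◇ φ) k     = ∃[ i ] V (suffix σ i) φ k
V σ (□ φ)       = alwaysV (λ i → V (suffix σ i) φ)
V σ (φ 𝒰 ψ)     = untilV (λ i → V (suffix σ i) φ) (λ i → V (suffix σ i) ψ)
V σ (φ ℛ ψ)     = releaseV (λ i → V (suffix σ i) φ) (λ i → V (suffix σ i) ψ)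

data NoAlwaysRelease {A : Set} : Form A → Set where
  atom : ∀ p → NoAlwaysRelease (atom p)
  neg  : ∀ {φ} → NoAlwaysRelease φ → NoAlwaysRelease (¬ᵣ φ)
  and  : ∀ {φ ψ} → NoAlwaysRelease φ → NoAlwaysRelease ψ → NoAlwaysRelease (φ ∧ᵣ ψ)
  or   : ∀ {φ ψ} → NoAlwaysRelease φ → NoAlwaysRelease ψ → NoAlwaysRelease (φ ∨ᵣ ψ)
  imp  : ∀ {φ ψ} → NoAlwaysRelease φ → NoAlwaysRelease ψ → NoAlwaysRelease (φ ⇛ ψ)
  next : ∀ {φ} → NoAlwaysRelease φ → NoAlwaysRelease (⊙ φ)
  ev   : ∀ {φ} → NoAlwaysRelease φ → NoAlwaysRelease (◇ φ)
  unt  : ∀ {φ ψ} → NoAlwaysRelease φ → NoAlwaysRelease ψ → NoAlwaysRelease (φ 𝒰 ψ)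

module Submission where

open import Defs
open import Data.Nat using (ℕ; suc)
open import Data.Fin using (Fin)
open import Level using (0ℓ)
open import Axiom.ExcludedMiddle using (ExcludedMiddle)
open import Function.Bundles using (_⇔_; mk⇔)
open import Data.Product using (_,_)
open import Data.Sum using (inj₁; inj₂)
open import Relation.Nullary using (¬_; yes; no; contradiction)

-- Only □ and ℛ define different bits of a value by different limit
-- behaviours; every other connective acts bitwise, so without them a formula
-- only takes the values 0000 and 1111.  For such a value a the robust
-- implication a → b is 1111 when a = 0000 and b when a = 1111, which is
-- exactly ¬a ∨ b.  Deciding a = 1111 needs excluded middle.

IsBoolean : Val → Set
IsBoolean a = ∀ j k → a j → a k

V-isBoolean : ∀ {n} {φ : Form (Fin (suc n))} → NoAlwaysRelease φ →
  ∀ (σ : Word n) → IsBoolean (V σ φ)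
V-isBoolean (atom p)    σ j k x          = x
V-isBoolean (neg h)     σ j k x          = x
V-isBoolean (and h₁ h₂) σ j k (x , y)    = V-isBoolean h₁ σ j k x , V-isBoolean h₂ σ j k y
V-isBoolean (or h₁ h₂)  σ j k (inj₁ x)   = inj₁ (V-isBoolean h₁ σ j k x)
V-isBoolean (or h₁ h₂)  σ j k (inj₂ y)   = inj₂ (V-isBoolean h₂ σ j k y)
V-isBoolean (imp h₁ h₂) σ j k (inj₁ a⪯b) = inj₁ a⪯b
V-isBoolean (imp h₁ h₂) σ j k (inj₂ y)   = inj₂ (V-isBoolean h₂ σ j k y)
V-isBoolean (next h)    σ j k x          = V-isBoolean h (suffix σ 1) j k x
V-isBoolean (ev h)      σ j k (i , x)    = i , V-isBoolean h (suffix σ i) j k x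
V-isBoolean (unt h₁ h₂) σ j k (m , y , x) =
  m , V-isBoolean h₂ (suffix σ m) j k y , λ i i<m → V-isBoolean h₁ (suffix σ i) j k (x i i<m)

¬isTop⇒⪯ : ∀ {a b} → IsBoolean a → ¬ isTop a → a ⪯ b
¬isTop⇒⪯ bool ¬top j aj = contradiction (λ k → bool j k aj) ¬top

impV⇔maxV-negV : ExcludedMiddle 0ℓ → ∀ {a b} → IsBoolean a →
  ∀ k → impV a b k ⇔ maxV (negV a) b k
impV⇔maxV-negV lem {a} {b} bool k = mk⇔ to from
  where
  to : impV a b k → maxV (negV a) b k
  to (inj₂ bk) = inj₂ bk
  to (inj₁ a⪯b) with lem {isTop a}
  ... | yes top  = inj₂ (a⪯b k (top k))
  ... | no  ¬top = inj₁ ¬top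

  from : maxV (negV a) b k → impV a b k
  from (inj₁ ¬top) = inj₁ (¬isTop⇒⪯ bool ¬top)
  from (inj₂ bk)   = inj₂ bk

mainTheorem4 : ExcludedMiddle 0ℓ →
    ∀ {n : ℕ} (φ ψ : Form (Fin (suc n))) → NoAlwaysRelease φ →
    ∀ (σ : Word n) (k : Fin 4) →
    V σ (φ ⇛ ψ) k ⇔ V σ ((¬ᵣ φ) ∨ᵣ ψ) k
mainTheorem4 lem φ ψ h σ = impV⇔maxV-negV lem (V-isBoolean h σ)
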